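{- If a constraint language $\Gamma$ over a finite domain $D$ is strongly blockwise decomposable (resp. strongly uniformly blockwise decomposable), then $\Gamma^{\bullet}:=\Gamma\cup\{S: S\subseteq D\}$ is also strongly blockwise decomposable (resp. strongly uniformly blockwise decomposable).
   Context: A constraint language is a finite set of relations $R\subseteq D^k$; subsets $S\subseteq D$ are unary relations. A constraint $R(x_1,\dots,x_k)$ has scope $\tilde u$ and solutions the maps $\beta:\tilde u\to D$ with $(\beta(x_1),\dots,\beta(x_k))\in R$. $\langle\Delta\rangle$ is the set of relations $R$ such that $R(x_1,\dots,x_k)$ (distinct variables) equals a projection of a conjunction of constraints with relations from $\Delta$ and equality (pp-definable). Projection $\pi_Y$ restricts solutions to $Y$; selection $R(\vec u)|_{x\in S}$ keeps solutions with $\beta(x)\in S$. $R(\vec u)$ is decomposable w.r.t. a partition $(V_1,\dots,V_\ell)$ of $\tilde u$ if it equals $\pi_{V_1}R(\vec u)\times\cdots\times\pi_{V_\ell}R(\vec u)$. For distinct $x,y\in\tilde u$ the selection matrix $M^R_{x,y}$ has entries $\pi_{\tilde u\setminus\{x,y\}}(R(\vec u)|_{x=a,y=b})$; proper block matrix: pairwise disjoint nonempty $A_1,\dots,A_k$, pairwise disjoint nonempty $B_1,\dots,B_k$ with entry $[a,b]$ nonempty iff $a\in A_\ell,b\in B_\ell$ for some $\ell$. $R(\vec u)$ is blockwise decomposable in $x,y$ if $M^R_{x,y}$ is a proper block matrix and each block constraint $R(\vec u)|_{x\in A_\ell,y\in B_\ell}$ is decomposable w.r.t. some partition $(V_\ell,W_\ell)$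 of $\tilde u$ with $x\in V_\ell,y\in W_\ell$; uniformly if one partition works for all blocks; (uniformly) blockwise decomposable if so for all pairs of distinct scope variables; relations likewise via distinct variables. $\Delta$ is strongly (uniformly) blockwise decomposable if every relation in $\langle\Delta\rangle$ is. -}

module Defs where

open import Data.Nat using (ℕ)
open import Data.Fin using (Fin)
open import Data.Bool using (Bool; true; false)
open import Data.Sum using (_⊎_; inj₁; inj₂; [_,_])
open import Data.Product using (Σ; ∃; _×_; _,_)
open import Data.List using (List)
open import Data.List.Relation.Unary.All using (All)
open import Relation.Binary.PropositionalEquality using (_≡_; _≢_)
open import Relation.Nullary using (¬_)
open import Function.Bundles using (_⇔_)

-- The finite domain D is Fin n.  A k-ary relation R ⊆ D^k is given by its
-- characteristic function on tuples (Fin k → D); the solutions of the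
-- constraint R(x₁,…,x_k) with distinct variables are exactly the
-- assignments β : Fin k → D with R β ≡ true.
Rel : ℕ → ℕ → Set
Rel n k = (Fin k → Fin n) → Bool

Subset : ℕ → Set
Subset n = Fin n → Bool

record Family (n : ℕ) : Set₁ where
  field
    Idx   : Set
    arity : Idx → ℕ
    rel   : (i : Idx) → Rel n (arity i)
open Family public

record ConstraintLanguage (n : ℕ) : Set where
  field
    size  : ℕ
    arity : Fin size → ℕ
    rel   : (i : Fin size) → Rel n (arity i)

toFamily : ∀ {n} → ConstraintLanguage n → Family n
toFamily Γ = record { Idx = Fin (ConstraintLanguage.size Γ)
                    ; arity = ConstraintLanguage.arity Γ
                    ; rel = ConstraintLanguage.rel Γ }

bullet : ∀ {n} → ConstraintLanguage n → Family n
bullet {n} Γ = record { Idx = Fin (ConstraintLanguage.size Γ) ⊎ Subset n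
                      ; arity = ar
                      ; rel = r }
  where
  ar : Fin (ConstraintLanguage.size Γ) ⊎ Subset n → ℕ
  ar (inj₁ i) = ConstraintLanguage.arity Γ i
  ar (inj₂ S) = 1
  r : (i : Fin (ConstraintLanguage.size Γ) ⊎ Subset n) → Rel n (ar i)
  r (inj₁ i) = ConstraintLanguage.rel Γ i
  r (inj₂ S) t = S (t Data.Fin.zero)

data Atom {n : ℕ} (Δ : Family n) (V : Set) : Set where
  relAtom : (i : Idx Δ) → (Fin (arity Δ i) → V) → Atom Δ V
  eqAtom  : V → V → Atom Δ V

Holds : ∀ {n} {Δ : Family n} {V : Set} → (V → Fin n) → Atom Δ V → Set
Holds {Δ = Δ} σ (relAtom i args) = rel Δ i (λ j → σ (args j)) ≡ true
Holds σ (eqAtom u v) = σ u ≡ σ v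

-- R ∈ ⟨Δ⟩: R(x₁,…,x_k) equals the projection onto x₁,…,x_k of a
-- conjunction of constraints over variables x₁,…,x_k (Fin k) and
-- e auxiliary variables (Fin e).
PPDefinable : ∀ {n} → Family n → ∀ {k} → Rel n k → Set
PPDefinable {n} Δ {k} R =
  Σ ℕ λ e → Σ (List (Atom Δ (Fin k ⊎ Fin e))) λ φ →
    ∀ (t : Fin k → Fin n) →
      (R t ≡ true) ⇔ (∃ λ (s : Fin e → Fin n) → All (Holds [ t , s ]) φ)

-- A constraint on scope Fin k given by its solution set P is decomposable
-- w.r.t. the partition (V, complement of V) of Fin k (V given by its
-- characteristic function): P = π_V P × π_W P.
Decomposable : ∀ {n k} → ((Fin k → Fin n) → Set) → (Fin k → Bool) → Set
Decomposable {n} {k} P V =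
  ∀ (β : Fin k → Fin n) →
    P β ⇔ ((∃ λ γ → P γ × (∀ z → V z ≡ true  → γ z ≡ β z))
         × (∃ λ δ → P δ × (∀ z → V z ≡ false → δ z ≡ β z)))

BlockConstraint : ∀ {n k} → Rel n k → Fin k → Fin k → Subset n → Subset n →
                  (Fin k → Fin n) → Set
BlockConstraint R x y A B β = (R β ≡ true) × (A (β x) ≡ true) × (B (β y) ≡ true)

EntryNonempty : ∀ {n k} → Rel n k → Fin k → Fin k → Fin n → Fin n → Set
EntryNonempty R x y a b = ∃ λ β → (R β ≡ true) × (β x ≡ a) × (β y ≡ b)

record ProperBlockStructure {n k : ℕ} (R : Rel n k) (x y : Fin k) : Set where
  field
    p       : ℕ
    A B     : Fin p → Subset n
    A-nonempty : ∀ ℓ → ∃ λ a → A ℓ a ≡ true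
    B-nonempty : ∀ ℓ → ∃ λ b → B ℓ b ≡ true
    A-disjoint : ∀ ℓ ℓ' a → ℓ ≢ ℓ' → ¬ ((A ℓ a ≡ true) × (A ℓ' a ≡ true))
    B-disjoint : ∀ ℓ ℓ' b → ℓ ≢ ℓ' → ¬ ((B ℓ b ≡ true) × (B ℓ' b ≡ true))
    entries : ∀ a b → EntryNonempty R x y a b ⇔ (∃ λ ℓ → (A ℓ a ≡ true) × (B ℓ b ≡ true))
open ProperBlockStructure public

BlockwiseDecomposableIn : ∀ {n k} → Rel n k → Fin k → Fin k → Set
BlockwiseDecomposableIn {n} {k} R x y =
  Σ (ProperBlockStructure R x y) λ bs →
    ∀ ℓ → ∃ λ (V : Fin k → Bool) → (V x ≡ true) × (V y ≡ false) ×
            Decomposable (BlockConstraint R x y (A bs ℓ) (B bs ℓ)) V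

UniformlyBlockwiseDecomposableIn : ∀ {n k} → Rel n k → Fin k → Fin k → Set
UniformlyBlockwiseDecomposableIn {n} {k} R x y =
  Σ (ProperBlockStructure R x y) λ bs →
    ∃ λ (V : Fin k → Bool) → (V x ≡ true) × (V y ≡ false) ×
      (∀ ℓ → Decomposable (BlockConstraint R x y (A bs ℓ) (B bs ℓ)) V)

BlockwiseDecomposable : ∀ {n k} → Rel n k → Set
BlockwiseDecomposable {k = k} R = ∀ (x y : Fin k) → x ≢ y → BlockwiseDecomposableIn R x y

UniformlyBlockwiseDecomposable : ∀ {n k} → Rel n k → Set
UniformlyBlockwiseDecomposable {k = k} R =
  ∀ (x y : Fin k) → x ≢ y → UniformlyBlockwiseDecomposableIn R x y

StronglyBlockwiseDecomposable : ∀ {n} → Family n → Set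
StronglyBlockwiseDecomposable {n} Δ =
  ∀ (k : ℕ) (R : Rel n k) → PPDefinable Δ R → BlockwiseDecomposable R

StronglyUniformlyBlockwiseDecomposable : ∀ {n} → Family n → Set
StronglyUniformlyBlockwiseDecomposable {n} Δ =
  ∀ (k : ℕ) (R : Rel n k) → PPDefinable Δ R → UniformlyBlockwiseDecomposable R

{-# OPTIONS --safe #-}
-- A relation R pp-definable over Γ• is the projection onto its free variables of a selection
-- T|_S, where T is defined by the Γ-atoms and equalities alone (so T ∈ ⟨Γ⟩ is blockwise
-- decomposable) and S collects the unary constraints.  If the selection matrix of T at (x, y)
-- has blocks A_ℓ × B_ℓ decomposing along V_ℓ, then that of R has blocks A′_ℓ × B′_ℓ, where
-- A′_ℓ (resp. B′_ℓ) are the x- (resp. y-) values of the solutions of block ℓ that satisfy the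
-- unary constraints on V_ℓ (resp. on its complement); blocks with an empty side are dropped.
-- Gluing such solutions along V_ℓ gives both the block shape and the decomposition of each new
-- block along V_ℓ restricted to the free variables, so uniformity is preserved as well.
-- Relations are functions on assignments, so deciding A′_ℓ by finite search needs the
-- relations of Γ to be extensional; this too follows from blockwise decomposability.
module Submission where

open import Defs
open import Data.Nat using (ℕ; zero; suc; _+_)
open import Data.Fin using (Fin; zero; suc; join; splitAt)
open import Data.Fin.Properties using (any?; splitAt-join; suc-injective; ↑ˡ-injective) renaming (_≟_ to _≟ᶠ_)
open import Data.Bool using (Bool; true; false; not; if_then_else_)
open import Data.Bool.Properties using () renaming (_≟_ to _≟ᵇ_)
open import Data.Sum using (_⊎_; inj₁; inj₂; [_,_])
open import Data.Product using (∃; _×_; _,_; proj₁; proj₂; map₁; map₂)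
open import Data.List using (List; []; _∷_; map)
open import Data.List.Relation.Unary.All as All using (All; []; _∷_)
open import Data.List.Relation.Unary.All.Properties using (map⁺; map⁻)
open import Data.Vec.Functional using () renaming (_∷_ to _∷ᵛ_)
open import Data.Vec.Functional.Properties using (∷-cong)
open import Data.Empty using (⊥-elim)
open import Function using (_∘_; const)
open import Function.Bundles using (_⇔_; mk⇔; module Equivalence)
open import Relation.Binary.PropositionalEquality using (_≡_; _≗_; refl; sym; trans; cong; subst)
open import Relation.Nullary using (¬_; Dec; yes; no; does)
open import Relation.Nullary.Decidable using (map′; _×-dec_; _→-dec_)

open Equivalence using (to; from)

does≡true⇔ : ∀ {A : Set} (a? : Dec A) → (does a? ≡ true) ⇔ A
does≡true⇔ (yes a) = mk⇔ (const a) (const refl)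
does≡true⇔ (no ¬a) = mk⇔ (λ ()) (⊥-elim ∘ ¬a)

either-side : ∀ b {A : Set} → (b ≡ true → A) → (not b ≡ true → A) → A
either-side true  onTrue _ = onTrue refl
either-side false _ onFalse = onFalse refl

Respects≗ : ∀ {n m} → ((Fin m → Fin n) → Set) → Set
Respects≗ P = ∀ {f g} → f ≗ g → P f → P g

Extensional : ∀ {n k} → Rel n k → Set
Extensional R = Respects≗ (λ β → R β ≡ true)

any-assignment? : ∀ {n} m {P : (Fin m → Fin n) → Set} →
                  Respects≗ P → (∀ β → Dec (P β)) → Dec (∃ P)
any-assignment? zero resp P? =
  map′ (_ ,_) (λ (β , Pβ) → resp (λ ()) Pβ) (P? (λ ()))
any-assignment? (suc m) resp P? =
  map′ (λ (a , β , Pβ) → a ∷ᵛ β , Pβ)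
       (λ (β , Pβ) → β zero , β ∘ suc , resp (∷-cong refl (λ _ → refl)) Pβ)
       (any? λ a → any-assignment? m (resp ∘ ∷-cong refl) (P? ∘ (a ∷ᵛ_)))

record Enumeration {p : ℕ} (P : Fin p → Set) : Set where
  field
    size            : ℕ
    index           : Fin size → Fin p
    index-injective : ∀ {i j} → index i ≡ index j → i ≡ j
    index-sound     : ∀ j → P (index j)
    index-complete  : ∀ {ℓ} → P ℓ → ∃ λ j → index j ≡ ℓ

module _ {p} {P : Fin (suc p) → Set} (E : Enumeration (P ∘ suc)) where
  open Enumeration E

  enumeration-skipping-zero : ¬ P zero → Enumeration P
  enumeration-skipping-zero ¬P0 = record
    { size = size
    ; index = suc ∘ index
    ; index-injective = index-injective ∘ suc-injective
    ; index-sound = index-sound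
    ; index-complete = complete
    }
    where
    complete : ∀ {ℓ} → P ℓ → ∃ λ j → suc (index j) ≡ ℓ
    complete {zero}  P0 = ⊥-elim (¬P0 P0)
    complete {suc ℓ} Pℓ = map₂ (cong suc) (index-complete Pℓ)

  enumeration-with-zero : P zero → Enumeration P
  enumeration-with-zero P0 = record
    { size = suc size
    ; index = index′
    ; index-injective = injective
    ; index-sound = sound
    ; index-complete = complete
    }
    where
    index′ : Fin (suc size) → Fin (suc p)
    index′ = zero ∷ᵛ (suc ∘ index)
    injective : ∀ {i j} → index′ i ≡ index′ j → i ≡ j
    injective {zero}  {zero}  _  = refl
    injective {suc i} {suc j} eq = cong suc (index-injective (suc-injective eq))
    sound : ∀ j → P (index′ j)
    sound zero    = P0
    sound (suc j) = index-sound j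
    complete : ∀ {ℓ} → P ℓ → ∃ λ j → index′ j ≡ ℓ
    complete {zero}  _  = zero , refl
    complete {suc ℓ} Pℓ with index-complete Pℓ
    ... | j , eq = suc j , cong suc eq

enumerate : ∀ {p} {P : Fin p → Set} → (∀ ℓ → Dec (P ℓ)) → Enumeration P
enumerate {zero} P? = record
  { size = 0 ; index = λ () ; index-injective = λ { {()} }
  ; index-sound = λ () ; index-complete = λ { {()} } }
enumerate {suc p} P? with P? zero
... | yes P0 = enumeration-with-zero (enumerate (P? ∘ suc)) P0
... | no ¬P0 = enumeration-skipping-zero (enumerate (P? ∘ suc)) ¬P0

module _ {n} {Δ : Family n} where

  rename : ∀ {V W : Set} → (V → W) → Atom Δ V → Atom Δ W
  rename f (relAtom i args) = relAtom i (f ∘ args)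
  rename f (eqAtom u v)     = eqAtom (f u) (f v)

  module _ {V W : Set} {α : W → Fin n} {f : V → W} where

    Holds-rename⁺ : ∀ {a : Atom Δ V} → Holds (α ∘ f) a → Holds α (rename f a)
    Holds-rename⁺ {relAtom _ _} h = h
    Holds-rename⁺ {eqAtom _ _}  h = h

    Holds-rename⁻ : ∀ {a : Atom Δ V} → Holds α (rename f a) → Holds (α ∘ f) a
    Holds-rename⁻ {relAtom _ _} h = h
    Holds-rename⁻ {eqAtom _ _}  h = h

  Holds? : ∀ {V : Set} (α : V → Fin n) (a : Atom Δ V) → Dec (Holds α a)
  Holds? α (relAtom i args) = _ ≟ᵇ true
  Holds? α (eqAtom u v)     = α u ≟ᶠ α v

  Holds-resp : ∀ {V : Set} {α α′ : V → Fin n} → (∀ i → Extensional (rel Δ i)) →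
               α ≗ α′ → ∀ {a : Atom Δ V} → Holds α a → Holds α′ a
  Holds-resp Δ-ext eq {relAtom i args} = Δ-ext i (eq ∘ args)
  Holds-resp Δ-ext eq {eqAtom u v} h   = trans (sym (eq u)) (trans h (eq v))

  ⟦_⟧ : ∀ {m} → List (Atom Δ (Fin m)) → Rel n m
  ⟦ ψ ⟧ β = does (All.all? (Holds? β) ψ)

  ⟦⟧-holds : ∀ {m} (ψ : List (Atom Δ (Fin m))) {β} → (⟦ ψ ⟧ β ≡ true) ⇔ All (Holds β) ψ
  ⟦⟧-holds ψ = does≡true⇔ (All.all? (Holds? _) ψ)

  ⟦⟧-extensional : ∀ {m} (ψ : List (Atom Δ (Fin m))) →
                   (∀ i → Extensional (rel Δ i)) → Extensional ⟦ ψ ⟧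
  ⟦⟧-extensional ψ Δ-ext eq h =
    from (⟦⟧-holds ψ) (All.map (Holds-resp Δ-ext eq) (to (⟦⟧-holds ψ) h))

  ⟦⟧-ppDefinable : ∀ {m} (ψ : List (Atom Δ (Fin m))) → PPDefinable Δ ⟦ ψ ⟧
  ⟦⟧-ppDefinable ψ = 0 , map (rename inj₁) ψ , λ β →
    mk⇔ (λ h → (λ ()) , map⁺ (All.map Holds-rename⁺ (to (⟦⟧-holds ψ) h)))
        (λ (_ , h) → from (⟦⟧-holds ψ) (All.map Holds-rename⁻ (map⁻ h)))

  witnesses-as-assignments :
    (∀ i → Extensional (rel Δ i)) → ∀ {k e} (ψ : List (Atom Δ (Fin k ⊎ Fin e))) (t : Fin k → Fin n) →
    (∃ λ s → All (Holds [ t , s ]) ψ) ⇔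
    (∃ λ β → All (Holds β) (map (rename (join k e)) ψ) × (β ∘ join k e ∘ inj₁ ≗ t))
  witnesses-as-assignments Δ-ext {k} {e} ψ t = mk⇔ forth back
    where
    forth : (∃ λ s → All (Holds [ t , s ]) ψ) →
            ∃ λ β → All (Holds β) (map (rename (join k e)) ψ) × (β ∘ join k e ∘ inj₁ ≗ t)
    forth (s , h) = β , map⁺ (All.map (Holds-rename⁺ ∘ Holds-resp Δ-ext through-β) h)
                      , λ i → cong [ t , s ] (splitAt-join k e (inj₁ i))
      where
      β : Fin (k + e) → Fin n
      β = [ t , s ] ∘ splitAt k
      through-β : [ t , s ] ≗ β ∘ join k e
      through-β u = cong [ t , s ] (sym (splitAt-join k e u))
    back : (∃ λ β → All (Holds β) (map (rename (join k e)) ψ) × (β ∘ join k e ∘ inj₁ ≗ t)) →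
           ∃ λ s → All (Holds [ t , s ]) ψ
    back (β , h , β-t) = β ∘ join k e ∘ inj₂ , All.map (Holds-resp Δ-ext split-β ∘ Holds-rename⁻) (map⁻ h)
      where
      split-β : β ∘ join k e ≗ [ t , β ∘ join k e ∘ inj₂ ]
      split-β (inj₁ i) = β-t i
      split-β (inj₂ j) = refl

Satisfies : ∀ {n} {V : Set} → (V → Fin n) → List (V × Subset n) → Set
Satisfies β = All (λ (z , S) → S (β z) ≡ true)

SatisfiesOn : ∀ {n} {V : Set} → (V → Bool) → (V → Fin n) → List (V × Subset n) → Set
SatisfiesOn c β = All (λ (z , S) → c z ≡ true → S (β z) ≡ true)

module _ {n} {V : Set} {us : List (V × Subset n)} where

  satisfies-split : ∀ {c β} → Satisfies β us ⇔ (SatisfiesOn c β us × SatisfiesOn (not ∘ c) β us)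
  satisfies-split {c} = mk⇔ (All.unzip ∘ All.map (λ h → const h , const h))
                            (All.zipWith λ {(z , _)} (h , h′) → either-side (c z) h h′)

  satisfiesOn-resp : ∀ {c β γ} → (∀ z → c z ≡ true → β z ≡ γ z) →
                     SatisfiesOn c β us → SatisfiesOn c γ us
  satisfiesOn-resp β≡γ = All.map λ {(z , S)} h cz → subst (λ v → S v ≡ true) (β≡γ z cz) (h cz)

  satisfiesOn? : ∀ c β → Dec (SatisfiesOn c β us)
  satisfiesOn? c β = All.all? (λ (z , S) → c z ≟ᵇ true →-dec S (β z) ≟ᵇ true) us

glue : ∀ {n m} → (Fin m → Bool) → (Fin m → Fin n) → (Fin m → Fin n) → Fin m → Fin n
glue V γ δ z = if V z then γ z else δ z

module _ {n m} {V : Fin m → Bool} {γ δ : Fin m → Fin n} where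

  glue-left : ∀ z → V z ≡ true → glue V γ δ z ≡ γ z
  glue-left z Vz with V z
  ... | true = refl

  glue-right : ∀ z → not (V z) ≡ true → glue V γ δ z ≡ δ z
  glue-right z Wz with V z
  ... | false = refl

  decomposable-glue : ∀ {P} → Decomposable P V → P γ → P δ → P (glue V γ δ)
  decomposable-glue P-dec Pγ Pδ =
    from (P-dec _) ((γ , Pγ , λ z → sym ∘ glue-left z) , (δ , Pδ , λ z → sym ∘ glue-right z ∘ cong not))

IsProjectionOfSelection : ∀ {n k m} → (Fin k → Fin m) → Rel n m → List (Fin m × Subset n) → Rel n k → Set
IsProjectionOfSelection emb T us R =
  ∀ t → (R t ≡ true) ⇔ ∃ λ β → (T β ≡ true) × Satisfies β us × (β ∘ emb ≗ t)

module ProjectedBlocks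
  {n k m} {emb : Fin k → Fin m} {T : Rel n m} {us : List (Fin m × Subset n)} {R : Rel n k}
  (T-ext : Extensional T) (R-def : IsProjectionOfSelection emb T us R)
  {x y : Fin k} (bs : ProperBlockStructure T (emb x) (emb y))
  (V : Fin (p bs) → Fin m → Bool) (V-x : ∀ ℓ → V ℓ (emb x) ≡ true) (V-y : ∀ ℓ → V ℓ (emb y) ≡ false)
  (V-decomposes : ∀ ℓ → Decomposable (BlockConstraint T (emb x) (emb y) (A bs ℓ) (B bs ℓ)) (V ℓ))
  where

  Block : Fin (p bs) → (Fin m → Fin n) → Set
  Block ℓ = BlockConstraint T (emb x) (emb y) (A bs ℓ) (B bs ℓ)

  Block-resp : ∀ ℓ → Respects≗ (Block ℓ)
  Block-resp ℓ eq (Tβ , Aβ , Bβ) =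
    T-ext eq Tβ , subst (λ a → A bs ℓ a ≡ true) (eq (emb x)) Aβ , subst (λ b → B bs ℓ b ≡ true) (eq (emb y)) Bβ

  Block? : ∀ ℓ β → Dec (Block ℓ β)
  Block? ℓ β = T β ≟ᵇ true ×-dec A bs ℓ (β (emb x)) ≟ᵇ true ×-dec B bs ℓ (β (emb y)) ≟ᵇ true

  Trace : Fin (p bs) → (Fin m → Bool) → Fin m → Fin n → Set
  Trace ℓ c z a = ∃ λ γ → Block ℓ γ × γ z ≡ a × SatisfiesOn c γ us

  Trace? : ∀ ℓ c z a → Dec (Trace ℓ c z a)
  Trace? ℓ c z a = any-assignment? m
    (λ eq (γ-block , γz , γ-sat) → Block-resp ℓ eq γ-block , trans (sym (eq z)) γz , satisfiesOn-resp (λ z _ → eq z) γ-sat)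
    (λ γ → Block? ℓ γ ×-dec γ z ≟ᶠ a ×-dec satisfiesOn? c γ)

  LeftTrace RightTrace : Fin (p bs) → Fin n → Set
  LeftTrace  ℓ = Trace ℓ (V ℓ) (emb x)
  RightTrace ℓ = Trace ℓ (not ∘ V ℓ) (emb y)

  LeftTrace? : ∀ ℓ a → Dec (LeftTrace ℓ a)
  LeftTrace? ℓ = Trace? ℓ (V ℓ) (emb x)

  RightTrace? : ∀ ℓ b → Dec (RightTrace ℓ b)
  RightTrace? ℓ = Trace? ℓ (not ∘ V ℓ) (emb y)

  LeftTrace⊆A : ∀ {ℓ a} → LeftTrace ℓ a → A bs ℓ a ≡ true
  LeftTrace⊆A (_ , (_ , Aγ , _) , refl , _) = Aγ

  RightTrace⊆B : ∀ {ℓ b} → RightTrace ℓ b → B bs ℓ b ≡ true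
  RightTrace⊆B (_ , (_ , _ , Bδ) , refl , _) = Bδ

  Surviving : Fin (p bs) → Set
  Surviving ℓ = ∃ (LeftTrace ℓ) × ∃ (RightTrace ℓ)

  open Enumeration (enumerate {P = Surviving} λ ℓ → any? (LeftTrace? ℓ) ×-dec any? (RightTrace? ℓ)) public

  A′ B′ : Fin size → Subset n
  A′ j = does ∘ LeftTrace? (index j)
  B′ j = does ∘ RightTrace? (index j)

  glue-traces : ∀ {ℓ γ δ} → Block ℓ γ → SatisfiesOn (V ℓ) γ us → Block ℓ δ → SatisfiesOn (not ∘ V ℓ) δ us →
                Block ℓ (glue (V ℓ) γ δ) × Satisfies (glue (V ℓ) γ δ) us
  glue-traces {ℓ} {γ} {δ} γ-block γ-sat δ-block δ-sat =
    decomposable-glue (V-decomposes ℓ) γ-block δ-block ,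
    from satisfies-split (satisfiesOn-resp (λ z → sym ∘ glue-left {V = V ℓ} {γ} {δ} z) γ-sat ,
                          satisfiesOn-resp (λ z → sym ∘ glue-right {V = V ℓ} {γ} {δ} z) δ-sat)

  A′-trace : ∀ {j a} → (A′ j a ≡ true) ⇔ LeftTrace (index j) a
  A′-trace {j} {a} = does≡true⇔ (LeftTrace? (index j) a)

  B′-trace : ∀ {j b} → (B′ j b ≡ true) ⇔ RightTrace (index j) b
  B′-trace {j} {b} = does≡true⇔ (RightTrace? (index j) b)

  block-lift : ∀ {j γ′} → BlockConstraint R x y (A′ j) (B′ j) γ′ →
               ∃ λ β → Block (index j) β × Satisfies β us × (β ∘ emb ≗ γ′)
  block-lift {j} {γ′} (Rγ′ , A′γ′ , B′γ′) with to (R-def γ′) Rγ′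
  ... | β , Tβ , β-sat , β-γ′ = β , (Tβ , Aβ , Bβ) , β-sat , β-γ′
    where
    Aβ : A bs (index j) (β (emb x)) ≡ true
    Aβ = subst (λ a → A bs (index j) a ≡ true) (sym (β-γ′ x)) (LeftTrace⊆A (to A′-trace A′γ′))
    Bβ : B bs (index j) (β (emb y)) ≡ true
    Bβ = subst (λ b → B bs (index j) b ≡ true) (sym (β-γ′ y)) (RightTrace⊆B (to B′-trace B′γ′))

  traces-of : ∀ {ℓ β} → Block ℓ β → Satisfies β us → LeftTrace ℓ (β (emb x)) × RightTrace ℓ (β (emb y))
  traces-of {β = β} β-block β-sat =
    (β , β-block , refl , proj₁ (to satisfies-split β-sat)) , (β , β-block , refl , proj₂ (to satisfies-split β-sat))

  surviving-index : ∀ {ℓ a b} → LeftTrace ℓ a × RightTrace ℓ b → ∃ λ j → (A′ j a ≡ true) × (B′ j b ≡ true)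
  surviving-index {a = a} {b} (left , right) with index-complete ((a , left) , (b , right))
  ... | j , refl = j , from A′-trace left , from B′-trace right

  entry⇒ : ∀ {a b} → EntryNonempty R x y a b → ∃ λ j → (A′ j a ≡ true) × (B′ j b ≡ true)
  entry⇒ (t , Rt , refl , refl) with to (R-def t) Rt
  ... | β , Tβ , β-sat , β-t with to (entries bs _ _) (β , Tβ , refl , refl)
  ... | ℓ , Aℓ , Bℓ with surviving-index (traces-of (Tβ , Aℓ , Bℓ) β-sat)
  ... | j , A′j , B′j = j , subst (λ a → A′ j a ≡ true) (β-t x) A′j , subst (λ b → B′ j b ≡ true) (β-t y) B′j

  entry⇐ : ∀ {a b} → (∃ λ j → (A′ j a ≡ true) × (B′ j b ≡ true)) → EntryNonempty R x y a b
  entry⇐ (j , A′a , B′b) with to A′-trace A′a | to B′-trace B′b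
  ... | γ , γ-block , refl , γ-sat | δ , δ-block , refl , δ-sat =
    β ∘ emb , from (R-def _) (β , proj₁ (proj₁ glued) , proj₂ glued , λ _ → refl) ,
    glue-left {V = V (index j)} {γ} {δ} (emb x) (V-x (index j)) ,
    glue-right {V = V (index j)} {γ} {δ} (emb y) (cong not (V-y (index j)))
    where
    β : Fin m → Fin n
    β = glue (V (index j)) γ δ
    glued : Block (index j) β × Satisfies β us
    glued = glue-traces γ-block γ-sat δ-block δ-sat

  projected-blocks : ProperBlockStructure R x y
  projected-blocks = record
    { p = size ; A = A′ ; B = B′
    ; A-nonempty = λ j → let a , left = proj₁ (index-sound j) in a , from A′-trace left
    ; B-nonempty = λ j → let b , right = proj₂ (index-sound j) in b , from B′-trace right
    ; A-disjoint = λ j j′ a j≢j′ (A′j , A′j′) →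
        A-disjoint bs _ _ a (j≢j′ ∘ index-injective) (LeftTrace⊆A (to A′-trace A′j) , LeftTrace⊆A (to A′-trace A′j′))
    ; B-disjoint = λ j j′ b j≢j′ (B′j , B′j′) →
        B-disjoint bs _ _ b (j≢j′ ∘ index-injective) (RightTrace⊆B (to B′-trace B′j) , RightTrace⊆B (to B′-trace B′j′))
    ; entries = λ a b → mk⇔ entry⇒ entry⇐
    }

  projected-decomposable : ∀ j → Decomposable (BlockConstraint R x y (A′ j) (B′ j)) (V (index j) ∘ emb)
  projected-decomposable j t = mk⇔ (λ h → (t , h , λ _ _ → refl) , (t , h , λ _ _ → refl)) glued
    where
    ℓ : Fin (p bs)
    ℓ = index j
    P : (Fin k → Fin n) → Set
    P = BlockConstraint R x y (A′ j) (B′ j)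
    glued : (∃ λ γ′ → P γ′ × (∀ z → V ℓ (emb z) ≡ true → γ′ z ≡ t z)) ×
            (∃ λ δ′ → P δ′ × (∀ z → V ℓ (emb z) ≡ false → δ′ z ≡ t z)) → P t
    glued ((γ′ , Pγ′@(_ , A′γ′ , _) , γ′-t) , (δ′ , Pδ′@(_ , _ , B′δ′) , δ′-t))
      with block-lift Pγ′ | block-lift Pδ′
    ... | γ , γ-block , γ-sat , γ-γ′ | δ , δ-block , δ-sat , δ-δ′ =
      from (R-def t) (glue (V ℓ) γ δ , proj₁ (proj₁ g) , proj₂ g , agrees) ,
      subst (λ a → A′ j a ≡ true) (γ′-t x (V-x ℓ)) A′γ′ ,
      subst (λ b → B′ j b ≡ true) (δ′-t y (V-y ℓ)) B′δ′
      where
      g : Block ℓ (glue (V ℓ) γ δ) × Satisfies (glue (V ℓ) γ δ) us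
      g = glue-traces γ-block (proj₁ (to satisfies-split γ-sat)) δ-block (proj₂ (to satisfies-split δ-sat))
      agrees : glue (V ℓ) γ δ ∘ emb ≗ t
      agrees i with V ℓ (emb i) in eq
      ... | true  = trans (γ-γ′ i) (γ′-t i eq)
      ... | false = trans (δ-δ′ i) (δ′-t i eq)

module _ {n k m} {emb : Fin k → Fin m} {T : Rel n m} {us : List (Fin m × Subset n)} {R : Rel n k}
         (T-ext : Extensional T) (R-def : IsProjectionOfSelection emb T us R) {x y : Fin k} where

  projection-preserves-blockwise :
    BlockwiseDecomposableIn T (emb x) (emb y) → BlockwiseDecomposableIn R x y
  projection-preserves-blockwise (bs , V-dec) =
    projected-blocks , λ j → V (index j) ∘ emb , V-x (index j) , V-y (index j) , projected-decomposable j
    where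
    V : Fin (p bs) → Fin m → Bool
    V ℓ = proj₁ (V-dec ℓ)
    V-x : ∀ ℓ → V ℓ (emb x) ≡ true
    V-x ℓ = proj₁ (proj₂ (V-dec ℓ))
    V-y : ∀ ℓ → V ℓ (emb y) ≡ false
    V-y ℓ = proj₁ (proj₂ (proj₂ (V-dec ℓ)))
    open ProjectedBlocks T-ext R-def bs V V-x V-y (λ ℓ → proj₂ (proj₂ (proj₂ (V-dec ℓ))))

  projection-preserves-uniformly-blockwise :
    UniformlyBlockwiseDecomposableIn T (emb x) (emb y) → UniformlyBlockwiseDecomposableIn R x y
  projection-preserves-uniformly-blockwise (bs , V , V-x , V-y , V-dec) =
    projected-blocks , V ∘ emb , V-x , V-y , projected-decomposable
    where
    open ProjectedBlocks T-ext R-def bs (const V) (const V-x) (const V-y) V-dec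

uniformly⇒blockwise : ∀ {n k} {R : Rel n k} {x y} →
                      UniformlyBlockwiseDecomposableIn R x y → BlockwiseDecomposableIn R x y
uniformly⇒blockwise (bs , V , V-x , V-y , V-dec) = bs , λ ℓ → V , V-x , V-y , V-dec ℓ

strongly-uniformly⇒strongly : ∀ {n} {Δ : Family n} →
                              StronglyUniformlyBlockwiseDecomposable Δ → StronglyBlockwiseDecomposable Δ
strongly-uniformly⇒strongly H k R R-pp x y x≢y = uniformly⇒blockwise (H k R R-pp x y x≢y)

blockwiseDecomposableIn⇒extensional : ∀ {n k} {R : Rel n k} {x y} →
                                      BlockwiseDecomposableIn R x y → Extensional R
-- f itself witnesses both halves of the decomposition of its block at g.
blockwiseDecomposableIn⇒extensional {x = x} {y} (bs , V-dec) {f} {g} f≗g Rf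
  with to (entries bs (f x) (f y)) (f , Rf , refl , refl)
... | ℓ , Aℓ , Bℓ with V-dec ℓ
... | V , _ , _ , decomposes =
  proj₁ (from (decomposes g) ((f , (Rf , Aℓ , Bℓ) , λ z _ → f≗g z) , (f , (Rf , Aℓ , Bℓ) , λ z _ → f≗g z)))

-- Padding by two dummy variables yields a pair of distinct variables even for relations of arity < 2.
padded : ∀ {n a} → Rel n a → Rel n (suc (suc a))
padded R t = R (λ j → t (suc (suc j)))

module _ {n} (Γ : ConstraintLanguage n) where
  open ConstraintLanguage Γ using () renaming (rel to relΓ)

  padded-ppDefinable : ∀ i → PPDefinable (toFamily Γ) (padded (relΓ i))
  padded-ppDefinable i = 0 , relAtom i (λ j → inj₁ (suc (suc j))) ∷ [] , λ t →
    mk⇔ (λ h → (λ ()) , h ∷ []) (λ { (_ , h ∷ []) → h })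

  relations-extensional : StronglyBlockwiseDecomposable (toFamily Γ) → Fin n → ∀ i → Extensional (relΓ i)
  relations-extensional H d i {f} {g} f≗g =
    blockwiseDecomposableIn⇒extensional (H _ _ (padded-ppDefinable i) zero (suc zero) (λ ()))
      {d ∷ᵛ d ∷ᵛ f} {d ∷ᵛ d ∷ᵛ g} (∷-cong refl (∷-cong refl f≗g))

  bullet-extensional : (Fin n → ∀ i → Extensional (relΓ i)) → Fin n → ∀ i → Extensional (rel (bullet Γ) i)
  bullet-extensional Γ-ext d (inj₁ i) = Γ-ext d i
  bullet-extensional Γ-ext d (inj₂ S) eq = subst (λ a → S a ≡ true) (eq zero)

module _ {n} {Γ : ConstraintLanguage n} {V : Set} where

  Γ-part : List (Atom (bullet Γ) V) → List (Atom (toFamily Γ) V)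
  Γ-part []                          = []
  Γ-part (relAtom (inj₁ i) args ∷ ψ) = relAtom i args ∷ Γ-part ψ
  Γ-part (relAtom (inj₂ _) _ ∷ ψ)    = Γ-part ψ
  Γ-part (eqAtom u v ∷ ψ)            = eqAtom u v ∷ Γ-part ψ

  unary-part : List (Atom (bullet Γ) V) → List (V × Subset n)
  unary-part []                          = []
  unary-part (relAtom (inj₁ _) _ ∷ ψ)    = unary-part ψ
  unary-part (relAtom (inj₂ S) args ∷ ψ) = (args zero , S) ∷ unary-part ψ
  unary-part (eqAtom _ _ ∷ ψ)            = unary-part ψ

  module _ {α : V → Fin n} where

    Holds-split : ∀ ψ → All (Holds α) ψ → All (Holds α) (Γ-part ψ) × Satisfies α (unary-part ψ)
    Holds-split []                       []       = [] , []
    Holds-split (relAtom (inj₁ _) _ ∷ ψ) (h ∷ hs) = map₁ (h ∷_) (Holds-split ψ hs)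
    Holds-split (relAtom (inj₂ _) _ ∷ ψ) (h ∷ hs) = map₂ (h ∷_) (Holds-split ψ hs)
    Holds-split (eqAtom _ _ ∷ ψ)         (h ∷ hs) = map₁ (h ∷_) (Holds-split ψ hs)

    Holds-merge : ∀ ψ → All (Holds α) (Γ-part ψ) → Satisfies α (unary-part ψ) → All (Holds α) ψ
    Holds-merge []                       _        _        = []
    Holds-merge (relAtom (inj₁ _) _ ∷ ψ) (h ∷ hs) ss       = h ∷ Holds-merge ψ hs ss
    Holds-merge (relAtom (inj₂ _) _ ∷ ψ) hs       (s ∷ ss) = s ∷ Holds-merge ψ hs ss
    Holds-merge (eqAtom _ _ ∷ ψ)         (h ∷ hs) ss       = h ∷ Holds-merge ψ hs ss

-- x serves only to read off an element of the domain from an assignment.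
module Γ•-Formula {n} (Γ : ConstraintLanguage n) (Γ-ext : Fin n → ∀ i → Extensional (ConstraintLanguage.rel Γ i))
                  {k e} (φ : List (Atom (bullet Γ) (Fin k ⊎ Fin e))) (x : Fin k) where

  φ′ : List (Atom (bullet Γ) (Fin (k + e)))
  φ′ = map (rename (join k e)) φ

  Γ-relation : Rel n (k + e)
  Γ-relation = ⟦ Γ-part φ′ ⟧

  Γ-relation-ppDefinable : PPDefinable (toFamily Γ) Γ-relation
  Γ-relation-ppDefinable = ⟦⟧-ppDefinable (Γ-part φ′)

  Γ-relation-extensional : Extensional Γ-relation
  Γ-relation-extensional {β} = ⟦⟧-extensional (Γ-part φ′) (Γ-ext (β (join k e (inj₁ x))))

  defines-projection : ∀ {R} → (∀ t → (R t ≡ true) ⇔ (∃ λ s → All (Holds [ t , s ]) φ)) →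
                       IsProjectionOfSelection (join k e ∘ inj₁) Γ-relation (unary-part φ′) R
  defines-projection R-def t =
    mk⇔ (separate ∘ to assignments ∘ to (R-def t)) (from (R-def t) ∘ from assignments ∘ merge)
    where
    assignments : (∃ λ s → All (Holds [ t , s ]) φ) ⇔ (∃ λ β → All (Holds β) φ′ × (β ∘ join k e ∘ inj₁ ≗ t))
    assignments = witnesses-as-assignments (bullet-extensional Γ Γ-ext (t x)) φ t
    separate : (∃ λ β → All (Holds β) φ′ × (β ∘ join k e ∘ inj₁ ≗ t)) →
               ∃ λ β → (Γ-relation β ≡ true) × Satisfies β (unary-part φ′) × (β ∘ join k e ∘ inj₁ ≗ t)
    separate (β , h , β-t) = β , from (⟦⟧-holds _) (proj₁ (Holds-split φ′ h)) , proj₂ (Holds-split φ′ h) , β-t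
    merge : (∃ λ β → (Γ-relation β ≡ true) × Satisfies β (unary-part φ′) × (β ∘ join k e ∘ inj₁ ≗ t)) →
            ∃ λ β → All (Holds β) φ′ × (β ∘ join k e ∘ inj₁ ≗ t)
    merge (β , Γβ , β-sat , β-t) = β , Holds-merge φ′ (to (⟦⟧-holds _) Γβ) β-sat , β-t

module _ {n} (Γ : ConstraintLanguage n) where

  bullet-preserves-blockwise :
    StronglyBlockwiseDecomposable (toFamily Γ) → StronglyBlockwiseDecomposable (bullet Γ)
  bullet-preserves-blockwise H k R (e , φ , R-def) x y x≢y =
    projection-preserves-blockwise Γ-relation-extensional (defines-projection R-def)
      (H _ _ Γ-relation-ppDefinable _ _ (x≢y ∘ ↑ˡ-injective e x y))
    where open Γ•-Formula Γ (relations-extensional Γ H) φ x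

  bullet-preserves-uniformly-blockwise :
    StronglyUniformlyBlockwiseDecomposable (toFamily Γ) → StronglyUniformlyBlockwiseDecomposable (bullet Γ)
  bullet-preserves-uniformly-blockwise H k R (e , φ , R-def) x y x≢y =
    projection-preserves-uniformly-blockwise Γ-relation-extensional (defines-projection R-def)
      (H _ _ Γ-relation-ppDefinable _ _ (x≢y ∘ ↑ˡ-injective e x y))
    where open Γ•-Formula Γ (relations-extensional Γ (strongly-uniformly⇒strongly H)) φ x

corollary14 : (n : ℕ) (Γ : ConstraintLanguage n) →
    (StronglyBlockwiseDecomposable (toFamily Γ) → StronglyBlockwiseDecomposable (bullet Γ))
    × (StronglyUniformlyBlockwiseDecomposable (toFamily Γ) → StronglyUniformlyBlockwiseDecomposable (bullet Γ))
corollary14 n Γ = bullet-preserves-blockwise Γ , bullet-preserves-uniformly-blockwise Γ
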